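{- Let $m$ be a non-negative integer, let $k$ be a positive integer, let $A=(a_0,\dots,a_{k-1})$ and $D=(d_0,\dots,d_{k-1})$ be $k$-tuples of elements of $\mathbb{Z}/m\mathbb{Z}$, and let $p_1,p_2$ be positive integers with $k\mid p_1$. Then the orbit of the sequence $S=\mathrm{IAP}(A,D)$ is periodic of period $(p_1,p_2)$ if and only if $\pi_{m/\gcd(p_1/k,m)}(D)=0$ and the row vector $(A\mid D)$ of length $2k$ satisfies $(A\mid D)\,\pi_m(P)=0$, where $P$ is the $2k\times 2k$ integer block matrix $$P=\begin{pmatrix} W & 0_k\\ T_k^{(p_2)} & W\end{pmatrix},\qquad W=C_k^{(p_2)}+(-1)^{p_2+1}I_k.$$
   Context: $\mathbb{Z}/0\mathbb{Z}$ is identified with $\mathbb{Z}$, and for a divisor $d$ of $m$, $\pi_d$ denotes the canonical projection $\mathbb{Z}/m\mathbb{Z}\to\mathbb{Z}/d\mathbb{Z}$ (applied entrywise to tuples and matrices); $\gcd(a,0)=a$. The interlaced arithmetic progression $\mathrm{IAP}(A,D)$ is the doubly infinite sequence $(u_j)_{j\in\mathbb{Z}}$ with $u_{qk+r}=a_r+q d_r$ for all $q\in\mathbb{Z}$, $r\in\{0,\dots,k-1\}$. The derived sequence of $(u_j)_{j\in\mathbb{Z}}$ is $(-u_j-u_{j+1})_{j\in\mathbb{Z}}$; the orbit of $S$ is the doubly indexed family $(a_{i,j})_{(i,j)\in\mathbb{N}\times\mathbb{Z}}$ with $a_{0,j}=u_j$ and $a_{i,j}=-a_{i-1,j}-a_{i-1,j+1}$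 for $i\ge1$ (i.e. row $i$ is the $i$-th iterated derived sequence). A doubly indexed family is periodic of period $(p,q)$ if $a_{i+q,j}=a_{i,j+p}=a_{i,j}$ for all $(i,j)\in\mathbb{N}\times\mathbb{Z}$. For non-negative integers $k\ge1$, $i$, the $k\times k$ integer matrices $C_k^{(i)}$ and $T_k^{(i)}$ are defined by $(C_k^{(i)})_{r,s}=\sum_{\alpha\in\mathbb{Z}}\binom{i}{\alpha k+r-s}$ and $(T_k^{(i)})_{r,s}=\sum_{\alpha\in\mathbb{Z}}\alpha\binom{i}{\alpha k+r-s}$ for $r,s\in\{1,\dots,k\}$, with the convention $\binom{a}{b}=0$ if $b<0$ or $b>a$. Tuples are row vectors and products with integer matrices are computed in $\mathbb{Z}/m\mathbb{Z}$. -}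

module Defs where

open import Data.Nat as ℕ using (ℕ; zero; suc; NonZero)
open import Data.Nat.DivMod as ℕD using ()
open import Data.Integer as ℤ using (ℤ; +_; -[1+_]; _+_; _*_; -_; _-_; 0ℤ; 1ℤ)
open import Data.Integer.DivMod as ℤD using (n%d<d)
open import Data.Integer.Divisibility using (_∣_)
open import Data.Fin using (Fin; toℕ; fromℕ<)
import Data.Fin
open import Relation.Nullary using (yes; no)
open import Data.Product using (_×_)

-- congruence modulo m in ℤ; equality in ℤ/mℤ (m = 0 gives equality in ℤ)
_≡_[mod_] : ℤ → ℤ → ℕ → Set
x ≡ y [mod m ] = (+ m) ∣ (x - y)

-- natural division with the (never used) convention quot m 0 = 0
quot : ℕ → ℕ → ℕ
quot m zero = 0
quot m (suc g) = m ℕD./ suc g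

sumFin : (n : ℕ) → (Fin n → ℤ) → ℤ
sumFin zero f = 0ℤ
sumFin (suc n) f = f Data.Fin.zero + sumFin n (λ i → f (Data.Fin.suc i))

binomℕ : ℕ → ℕ → ℕ
binomℕ n zero = 1
binomℕ zero (suc b) = 0
binomℕ (suc n) (suc b) = binomℕ n b ℕ.+ binomℕ n (suc b)

binom : ℕ → ℤ → ℤ
binom i (+ b) = + binomℕ i b
binom i -[1+ b ] = 0ℤ

sumAlpha : ℕ → (ℤ → ℤ) → ℤ
sumAlpha n f = f (ℤ.- 1ℤ) + go n
  where
  go : ℕ → ℤ
  go zero = f 0ℤ
  go (suc n) = f (+ suc n) + go n

-- (C_k^{(i)})_{r,s} = Σ_{α∈ℤ} binom(i, αk + r - s).
-- For 0 ≤ r,s < k the summand vanishes unless -1 ≤ α ≤ i, so the sum over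
-- α ∈ {-1,…,i} is the full sum over ℤ.
Cmat : (k i : ℕ) → Fin k → Fin k → ℤ
Cmat k i r s = sumAlpha i (λ α → binom i (α * + k + + toℕ r - + toℕ s))

Tmat : (k i : ℕ) → Fin k → Fin k → ℤ
Tmat k i r s = sumAlpha i (λ α → α * binom i (α * + k + + toℕ r - + toℕ s))

signPow : ℕ → ℤ
signPow zero = 1ℤ
signPow (suc n) = - signPow n

Imat : (k : ℕ) → Fin k → Fin k → ℤ
Imat k r s with toℕ r ℕ.≟ toℕ s
... | yes _ = 1ℤ
... | no _ = 0ℤ

Wmat : (k p : ℕ) → Fin k → Fin k → ℤ
Wmat k p r s = Cmat k p r s + signPow (suc p) * Imat k r s

IAP : (k : ℕ) .{{_ : NonZero k}} → (Fin k → ℤ) → (Fin k → ℤ) → ℤ → ℤ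
IAP k A D j = A r + q * D r
  where
  q : ℤ
  q = j ℤD./ + k
  r : Fin k
  r = fromℕ< (n%d<d j (+ k))

orbit : (ℤ → ℤ) → ℕ → ℤ → ℤ
orbit u zero j = u j
orbit u (suc i) j = - orbit u i j - orbit u i (j + 1ℤ)

Periodic : ℕ → (ℕ → ℤ → ℤ) → ℕ → ℕ → Set
Periodic m a p q = ∀ (i : ℕ) (j : ℤ) →
  (a (i ℕ.+ q) j ≡ a i j [mod m ]) × (a i (j + + p) ≡ a i j [mod m ])

open import Data.Sum using (inj₁; inj₂)
open import Data.Fin using (splitAt)

Pmat : (k p : ℕ) → Fin (k ℕ.+ k) → Fin (k ℕ.+ k) → ℤ
Pmat k p r s with splitAt k r | splitAt k s
... | inj₁ r' | inj₁ s' = Wmat k p r' s'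
... | inj₁ r' | inj₂ s' = 0ℤ
... | inj₂ r' | inj₁ s' = Tmat k p r' s'
... | inj₂ r' | inj₂ s' = Wmat k p r' s'

concatRow : (k : ℕ) → (Fin k → ℤ) → (Fin k → ℤ) → Fin (k ℕ.+ k) → ℤ
concatRow k A D r with splitAt k r
... | inj₁ r' = A r'
... | inj₂ r' = D r'

vecMat : (n : ℕ) → (Fin n → ℤ) → (Fin n → Fin n → ℤ) → Fin n → ℤ
vecMat n v M s = sumFin n (λ r → v r * M r s)

-- Row p of the orbit is (-1)^p Σ_t binom(p,t) u(j+t), and the derivation step is linear and
-- commutes with shifts, so the orbit is (p₁, p₂)-periodic iff row 0 is p₁-periodic and row p₂
-- agrees with row 0 modulo m. For u = IAP(A, D) and p₁ = ck one has u(j + p₁) - u(j) = c·D_{j mod k},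
-- and m ∣ c·d iff m / gcd(c, m) ∣ d. Grouping the binomial sum by residues mod k produces the
-- entries of C and T: at j = qk + s the difference of rows p₂ and 0 is ±(x_s + q·y_s), where
-- (x | y) = (A | D)·P, and this vanishes modulo m for every q iff x_s and y_s do.

module Submission where

open import Defs
open import Data.Empty using (⊥-elim)
open import Data.Fin as Fin using (Fin; toℕ; fromℕ<; _↑ˡ_; _↑ʳ_; punchIn; splitAt)
import Data.Fin.Properties as FinP
open import Data.Fin.Patterns using (0F)
open import Data.Integer as ℤ using (ℤ; +_; _+_; _*_; -_; _-_; _⊖_; 0ℤ; 1ℤ; -1ℤ)
open import Data.Integer.DivMod using (n%d<d; a≡a%n+[a/n]*n)
import Data.Integer.Divisibility.Signed as ℤ∣
import Data.Integer.Properties as ℤP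
open import Data.Integer.Tactic.RingSolver using (solve-∀)
open import Data.Nat as ℕ using (ℕ; zero; suc; NonZero; _<_; _≤_)
open import Data.Nat.Coprimality as Coprime using (coprime-/gcd; coprime-divisor)
open import Data.Nat.Divisibility as ℕ∣ using (_∣_)
open import Data.Nat.DivMod as ℕD using (_/_)
open import Data.Nat.GCD using (gcd; gcd[m,n]∣m; gcd[m,n]∣n; gcd[m,n]≢0)
import Data.Nat.Properties as ℕP
open import Data.Product using (_,_; _×_; proj₁; proj₂)
open import Data.Product.Function.NonDependent.Propositional using (_×-⇔_)
open import Data.Sum using (inj₁; inj₂)
open import Function.Base using (_∘_)
open import Function.Bundles using (_⇔_; mk⇔; Equivalence)
open import Function.Construct.Composition using (_⇔-∘_)
open import Relation.Nullary using (yes; no)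
open import Relation.Binary.PropositionalEquality
open ≡-Reasoning

open import Algebra.Properties.AbelianGroup ℤP.+-0-abelianGroup using (∙-cancelˡ)
open import Algebra.Properties.Semiring.Sum ℤP.+-*-semiring
  using ( sum-syntax; sum-cong-≗; sum-init-last; sum-replicate-zero; sum-remove
        ; ∑-distrib-+; ∑-comm; *-distribˡ-sum)

sumFin≡∑ : ∀ n (f : Fin n → ℤ) → sumFin n f ≡ ∑[ i < n ] f i
sumFin≡∑ zero    f = refl
sumFin≡∑ (suc n) f = cong (_+_ (f 0F)) (sumFin≡∑ n (f ∘ Fin.suc))

∑-0 : ∀ n {f : Fin n → ℤ} → (∀ i → f i ≡ 0ℤ) → ∑[ i < n ] f i ≡ 0ℤ
∑-0 n f≗0 = trans (sum-cong-≗ f≗0) (sum-replicate-zero n)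

∑-↑ : ∀ a b (f : Fin (a ℕ.+ b) → ℤ) →
      ∑[ i < a ℕ.+ b ] f i ≡ ∑[ i < a ] f (i ↑ˡ b) + ∑[ i < b ] f (a ↑ʳ i)
∑-↑ zero    b f = sym (ℤP.+-identityˡ _)
∑-↑ (suc a) b f = trans (cong (_+_ (f 0F)) (∑-↑ a b (f ∘ Fin.suc)))
  (sym (ℤP.+-assoc (f 0F) (∑[ i < a ] f (Fin.suc (i ↑ˡ b))) (∑[ i < b ] f (Fin.suc (a ↑ʳ i)))))

↑-cases : ∀ {m n} {P : Fin (m ℕ.+ n) → Set} → (∀ i → P (i ↑ˡ n)) → (∀ j → P (m ↑ʳ j)) → ∀ s → P s
↑-cases {m} {P = P} left right s with splitAt m s in eq
... | inj₁ i = subst P (FinP.splitAt⁻¹-↑ˡ eq) (left i)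
... | inj₂ j = subst P (FinP.splitAt⁻¹-↑ʳ eq) (right j)

∑ℕ-split : ∀ a b (f : ℕ → ℤ) →
           ∑[ i < a ℕ.+ b ] f (toℕ i) ≡ ∑[ i < a ] f (toℕ i) + ∑[ i < b ] f (a ℕ.+ toℕ i)
∑ℕ-split a b f = begin
  ∑[ i < a ℕ.+ b ] f (toℕ i)
    ≡⟨ ∑-↑ a b (f ∘ toℕ) ⟩
  ∑[ i < a ] f (toℕ (i ↑ˡ b)) + ∑[ i < b ] f (toℕ (a ↑ʳ i))
    ≡⟨ cong₂ _+_ (sum-cong-≗ {a} (λ i → cong f (FinP.toℕ-↑ˡ i b)))
                 (sum-cong-≗ {b} (λ i → cong f (FinP.toℕ-↑ʳ a i))) ⟩
  ∑[ i < a ] f (toℕ i) + ∑[ i < b ] f (a ℕ.+ toℕ i) ∎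

∑ℕ-last : ∀ n (f : ℕ → ℤ) → ∑[ i < suc n ] f (toℕ i) ≡ ∑[ i < n ] f (toℕ i) + f n
∑ℕ-last n f = trans (sum-init-last {n} (f ∘ toℕ))
  (cong₂ _+_ (sum-cong-≗ {n} (cong f ∘ FinP.toℕ-inject₁)) (cong f (FinP.toℕ-fromℕ n)))

∑ℕ-window : ∀ {N} a b (f : ℕ → ℤ) → a ℕ.+ b ≤ N →
            (∀ n → n < a → f n ≡ 0ℤ) → (∀ e → f (a ℕ.+ (b ℕ.+ e)) ≡ 0ℤ) →
            ∑[ n < N ] f (toℕ n) ≡ ∑[ t < b ] f (a ℕ.+ toℕ t)
∑ℕ-window {N} a b f a+b≤N below above with ℕP.m≤n⇒∃[o]m+o≡n a+b≤N
... | e , refl = begin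
  ∑[ n < a ℕ.+ b ℕ.+ e ] f (toℕ n)
    ≡⟨ ∑ℕ-split (a ℕ.+ b) e f ⟩
  ∑[ n < a ℕ.+ b ] f (toℕ n) + ∑[ n < e ] f (a ℕ.+ b ℕ.+ toℕ n)
    ≡⟨ cong₂ _+_ (∑ℕ-split a b f)
                 (∑-0 e (λ n → trans (cong f (ℕP.+-assoc a b (toℕ n))) (above (toℕ n)))) ⟩
  ∑[ n < a ] f (toℕ n) + ∑[ t < b ] f (a ℕ.+ toℕ t) + 0ℤ
    ≡⟨ cong (λ x → x + ∑[ t < b ] f (a ℕ.+ toℕ t) + 0ℤ) (∑-0 a (λ n → below _ (FinP.toℕ<n n))) ⟩
  0ℤ + ∑[ t < b ] f (a ℕ.+ toℕ t) + 0ℤ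
    ≡⟨ trans (ℤP.+-identityʳ _) (ℤP.+-identityˡ _) ⟩
  ∑[ t < b ] f (a ℕ.+ toℕ t) ∎

∑∑-block : ∀ N k (H : ℕ → ℤ) →
           ∑[ i < N ] ∑[ r < k ] H (toℕ i ℕ.* k ℕ.+ toℕ r) ≡ ∑[ n < N ℕ.* k ] H (toℕ n)
∑∑-block zero    k H = refl
∑∑-block (suc N) k H = begin
  ∑[ r < k ] H (toℕ r) + ∑[ i < N ] ∑[ r < k ] H (k ℕ.+ toℕ i ℕ.* k ℕ.+ toℕ r)
    ≡⟨ cong (_+_ (∑[ r < k ] H (toℕ r)))
            (sum-cong-≗ {N} (λ i → sum-cong-≗ {k} (λ r → cong H (ℕP.+-assoc k (toℕ i ℕ.* k) (toℕ r))))) ⟩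
  ∑[ r < k ] H (toℕ r) + ∑[ i < N ] ∑[ r < k ] H (k ℕ.+ (toℕ i ℕ.* k ℕ.+ toℕ r))
    ≡⟨ cong (_+_ (∑[ r < k ] H (toℕ r))) (∑∑-block N k (H ∘ (k ℕ.+_))) ⟩
  ∑[ r < k ] H (toℕ r) + ∑[ n < N ℕ.* k ] H (k ℕ.+ toℕ n)
    ≡⟨ ∑ℕ-split k (N ℕ.* k) H ⟨
  ∑[ n < suc N ℕ.* k ] H (toℕ n) ∎

-- The inner sum of sumAlpha is local to its definition, hence the implicit z.
sumAlpha-suc : ∀ n (f : ℤ → ℤ) → sumAlpha (suc n) f ≡ sumAlpha n f + f (+ suc n)
sumAlpha-suc n f = swap (f -1ℤ) (f (+ suc n))
  where
  swap : ∀ x y {z : ℤ} → x + (y + z) ≡ x + z + y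
  swap x y {z} = trans (cong (_+_ x) (ℤP.+-comm y z)) (sym (ℤP.+-assoc x z y))

sumAlpha≡∑ : ∀ n (f : ℤ → ℤ) → sumAlpha n f ≡ ∑[ i < suc (suc n) ] f (-1ℤ + + toℕ i)
sumAlpha≡∑ zero    f = cong (_+_ (f -1ℤ)) (sym (ℤP.+-identityʳ _))
sumAlpha≡∑ (suc n) f = begin
  sumAlpha (suc n) f
    ≡⟨ sumAlpha-suc n f ⟩
  sumAlpha n f + f (+ suc n)
    ≡⟨ cong (_+ f (+ suc n)) (sumAlpha≡∑ n f) ⟩
  ∑[ i < suc (suc n) ] f (-1ℤ + + toℕ i) + f (+ suc n)
    ≡⟨ ∑ℕ-last (suc (suc n)) (λ i → f (-1ℤ + + i)) ⟨
  ∑[ i < suc (suc (suc n)) ] f (-1ℤ + + toℕ i) ∎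

sumAlpha-scale : ∀ n a {f g : ℤ → ℤ} → (∀ x → a * f x ≡ g x) → a * sumAlpha n f ≡ sumAlpha n g
sumAlpha-scale n a {f} {g} g≗ = begin
  a * sumAlpha n f
    ≡⟨ cong (_*_ a) (sumAlpha≡∑ n f) ⟩
  a * ∑[ i < N ] f (α i)
    ≡⟨ *-distribˡ-sum {N} a (f ∘ α) ⟩
  ∑[ i < N ] (a * f (α i))
    ≡⟨ sum-cong-≗ {N} (g≗ ∘ α) ⟩
  ∑[ i < N ] g (α i)
    ≡⟨ sumAlpha≡∑ n g ⟨
  sumAlpha n g ∎
  where
  N = suc (suc n)
  α : Fin N → ℤ
  α i = -1ℤ + + toℕ i

sumAlpha-linear : ∀ n a b {f g h : ℤ → ℤ} → (∀ x → a * f x + b * g x ≡ h x) →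
                  a * sumAlpha n f + b * sumAlpha n g ≡ sumAlpha n h
sumAlpha-linear n a b {f} {g} {h} h≗ = begin
  a * sumAlpha n f + b * sumAlpha n g
    ≡⟨ cong₂ _+_ (sumAlpha-scale n a (λ _ → refl)) (sumAlpha-scale n b (λ _ → refl)) ⟩
  sumAlpha n (λ x → a * f x) + sumAlpha n (λ x → b * g x)
    ≡⟨ cong₂ _+_ (sumAlpha≡∑ n (λ x → a * f x)) (sumAlpha≡∑ n (λ x → b * g x)) ⟩
  ∑[ i < N ] (a * f (α i)) + ∑[ i < N ] (b * g (α i))
    ≡⟨ ∑-distrib-+ {N} (λ i → a * f (α i)) (λ i → b * g (α i)) ⟨
  ∑[ i < N ] (a * f (α i) + b * g (α i))
    ≡⟨ sum-cong-≗ {N} (h≗ ∘ α) ⟩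
  ∑[ i < N ] h (α i)
    ≡⟨ sumAlpha≡∑ n h ⟨
  sumAlpha n h ∎
  where
  N = suc (suc n)
  α : Fin N → ℤ
  α i = -1ℤ + + toℕ i

∑-sumAlpha-window : ∀ k p (F : ℤ → ℤ) →
  ∑[ r < k ] sumAlpha p (λ α → F (α * + k + + toℕ r)) ≡ ∑[ n < suc (suc p) ℕ.* k ] F (- + k + + toℕ n)
∑-sumAlpha-window k p F = begin
  ∑[ r < k ] sumAlpha p (λ α → F (α * + k + + toℕ r))
    ≡⟨ sum-cong-≗ {k} (λ r → sumAlpha≡∑ p (λ α → F (α * + k + + toℕ r))) ⟩
  ∑[ r < k ] ∑[ i < 2+p ] F ((-1ℤ + + toℕ i) * + k + + toℕ r)
    ≡⟨ ∑-comm {k} {2+p} (λ r i → F ((-1ℤ + + toℕ i) * + k + + toℕ r)) ⟩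
  ∑[ i < 2+p ] ∑[ r < k ] F ((-1ℤ + + toℕ i) * + k + + toℕ r)
    ≡⟨ sum-cong-≗ {2+p} (λ i → sum-cong-≗ {k} (λ r → cong F (position (toℕ i) (toℕ r)))) ⟩
  ∑[ i < 2+p ] ∑[ r < k ] F (- + k + + (toℕ i ℕ.* k ℕ.+ toℕ r))
    ≡⟨ ∑∑-block 2+p k (λ n → F (- + k + + n)) ⟩
  ∑[ n < 2+p ℕ.* k ] F (- + k + + toℕ n) ∎
  where
  2+p = suc (suc p)
  ring : ∀ i k r → (-1ℤ + i) * k + r ≡ - k + (i * k + r)
  ring = solve-∀
  position : ∀ i r → (-1ℤ + + i) * + k + + r ≡ - + k + + (i ℕ.* k ℕ.+ r)
  position i r = trans (ring (+ i) (+ k) (+ r))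
    (cong (_+_ (- + k)) (sym (trans (ℤP.pos-+ (i ℕ.* k) r) (cong (_+ + r) (ℤP.pos-* i k)))))

-- Binomial sums and the closed form of the orbit

<⇒binomℕ≡0 : ∀ {n b} → n < b → binomℕ n b ≡ 0
<⇒binomℕ≡0 {zero}  {suc b} _           = refl
<⇒binomℕ≡0 {suc n} {suc b} (ℕ.s≤s n<b) =
  cong₂ ℕ._+_ (<⇒binomℕ≡0 n<b) (<⇒binomℕ≡0 (ℕP.m<n⇒m<1+n n<b))

binom-⊖-< : ∀ p {m n} → m < n → binom p (m ⊖ n) ≡ 0ℤ
binom-⊖-< p {zero}  {suc n} _           = refl
binom-⊖-< p {suc m} {suc n} (ℕ.s≤s m<n) =
  trans (cong (binom p) (ℤP.[1+m]⊖[1+n]≡m⊖n m n)) (binom-⊖-< p m<n)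

binom-+⊖ : ∀ p m t → binom p ((m ℕ.+ t) ⊖ m) ≡ + binomℕ p t
binom-+⊖ p m t = cong (binom p) (trans (ℤP.⊖-≥ (ℕP.m≤m+n m t)) (cong +_ (ℕP.m+n∸m≡n m t)))

binomialSum : (ℤ → ℤ) → ℕ → ℤ → ℤ
binomialSum u p j = ∑[ t < suc p ] (+ binomℕ p (toℕ t) * u (j + + toℕ t))

binomialSum-suc : ∀ u p j → binomialSum u (suc p) j ≡ binomialSum u p j + binomialSum u p (j + 1ℤ)
binomialSum-suc u p j = begin
  u₀ + ∑[ t < suc p ] (+ binomℕ (suc p) (suc (toℕ t)) * u (j + + suc (toℕ t)))
    ≡⟨ cong (_+_ u₀) (trans (sum-cong-≗ {suc p} (pascal ∘ toℕ))
                            (∑-distrib-+ {suc p} (next ∘ toℕ) (g ∘ toℕ))) ⟩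
  u₀ + (∑[ t < suc p ] next (toℕ t) + ∑[ t < suc p ] g (toℕ t))
    ≡⟨ cong (λ x → u₀ + (∑[ t < suc p ] next (toℕ t) + x)) (∑ℕ-last p g) ⟩
  u₀ + (binomialSum u p (j + 1ℤ) + (∑[ t < p ] g (toℕ t) + g p))
    ≡⟨ cong (λ x → u₀ + (binomialSum u p (j + 1ℤ) + (∑[ t < p ] g (toℕ t) + x))) g[p]≡0 ⟩
  u₀ + (binomialSum u p (j + 1ℤ) + (∑[ t < p ] g (toℕ t) + 0ℤ))
    ≡⟨ rearrange u₀ (binomialSum u p (j + 1ℤ)) (∑[ t < p ] g (toℕ t)) ⟩
  binomialSum u p j + binomialSum u p (j + 1ℤ) ∎
  where
  u₀ = + 1 * u (j + + 0)
  next g : ℕ → ℤ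
  next t = + binomℕ p t * u (j + 1ℤ + + t)
  g t = + binomℕ p (suc t) * u (j + + suc t)
  pascal : ∀ t → + binomℕ (suc p) (suc t) * u (j + + suc t) ≡ next t + g t
  pascal t = begin
    + (binomℕ p t ℕ.+ binomℕ p (suc t)) * u (j + + suc t)
      ≡⟨ cong (λ x → x * u (j + + suc t)) (ℤP.pos-+ (binomℕ p t) (binomℕ p (suc t))) ⟩
    (+ binomℕ p t + + binomℕ p (suc t)) * u (j + + suc t)
      ≡⟨ ℤP.*-distribʳ-+ (u (j + + suc t)) (+ binomℕ p t) (+ binomℕ p (suc t)) ⟩
    + binomℕ p t * u (j + + suc t) + g t
      ≡⟨ cong (λ x → + binomℕ p t * u x + g t) (sym (ℤP.+-assoc j 1ℤ (+ t))) ⟩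
    next t + g t ∎
  g[p]≡0 : g p ≡ 0ℤ
  g[p]≡0 = cong (λ b → + b * u (j + + suc p)) (<⇒binomℕ≡0 (ℕP.n<1+n p))
  rearrange : ∀ a b c → a + (b + (c + 0ℤ)) ≡ a + c + b
  rearrange = solve-∀

signPow-square : ∀ p → signPow p * signPow p ≡ 1ℤ
signPow-square zero    = refl
signPow-square (suc p) = trans (ring (signPow p)) (signPow-square p)
  where
  ring : ∀ a → - a * - a ≡ a * a
  ring = solve-∀

orbit≡binomialSum : ∀ u p j → orbit u p j ≡ signPow p * binomialSum u p j
orbit≡binomialSum u zero    j = trans (cong u (sym (ℤP.+-identityʳ j))) (ring (u (j + + 0)))
  where
  ring : ∀ a → a ≡ 1ℤ * (+ 1 * a + 0ℤ)
  ring = solve-∀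
orbit≡binomialSum u (suc p) j = begin
  - orbit u p j - orbit u p (j + 1ℤ)
    ≡⟨ cong₂ (λ a b → - a - b) (orbit≡binomialSum u p j) (orbit≡binomialSum u p (j + 1ℤ)) ⟩
  - (σ * binomialSum u p j) - σ * binomialSum u p (j + 1ℤ)
    ≡⟨ ring σ (binomialSum u p j) (binomialSum u p (j + 1ℤ)) ⟩
  - σ * (binomialSum u p j + binomialSum u p (j + 1ℤ))
    ≡⟨ cong (λ x → - σ * x) (binomialSum-suc u p j) ⟨
  - σ * binomialSum u (suc p) j ∎
  where
  σ = signPow p
  ring : ∀ s a b → - (s * a) - s * b ≡ - s * (a + b)
  ring = solve-∀

binomialSum-shift : ∀ {u v : ℤ → ℤ} c q → (∀ y → u (c + y) ≡ u y + q * v y) →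
                    ∀ p x → binomialSum u p (c + x) ≡ binomialSum u p x + q * binomialSum v p x
binomialSum-shift {u} {v} c q shift p x = begin
  ∑[ t < suc p ] (C t * u (c + x + + toℕ t))
    ≡⟨ sum-cong-≗ {suc p} (λ t → cong (λ y → C t * y)
         (trans (cong u (ℤP.+-assoc c x (+ toℕ t))) (shift (x + + toℕ t)))) ⟩
  ∑[ t < suc p ] (C t * (u (x + + toℕ t) + q * v (x + + toℕ t)))
    ≡⟨ sum-cong-≗ {suc p} (λ t → distrib (C t) (u (x + + toℕ t)) q (v (x + + toℕ t))) ⟩
  ∑[ t < suc p ] (C t * u (x + + toℕ t) + q * (C t * v (x + + toℕ t)))
    ≡⟨ ∑-distrib-+ {suc p} (λ t → C t * u (x + + toℕ t)) (λ t → q * (C t * v (x + + toℕ t))) ⟩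
  binomialSum u p x + ∑[ t < suc p ] (q * (C t * v (x + + toℕ t)))
    ≡⟨ cong (_+_ (binomialSum u p x)) (*-distribˡ-sum {suc p} q (λ t → C t * v (x + + toℕ t))) ⟨
  binomialSum u p x + q * binomialSum v p x ∎
  where
  C : Fin (suc p) → ℤ
  C t = + binomℕ p (toℕ t)
  distrib : ∀ b a q d → b * (a + q * d) ≡ b * a + q * (b * d)
  distrib = solve-∀

-- Euclidean division by k and interlaced arithmetic progressions

module _ (k : ℕ) .{{_ : NonZero k}} where

  remainder : ℤ → Fin k
  remainder x = fromℕ< (n%d<d x (+ k))

  quotient : ℤ → ℤ
  quotient x = x ℤ./ + k

  euclid : ∀ x → x ≡ quotient x * + k + + toℕ (remainder x)
  euclid x = trans (a≡a%n+[a/n]*n x (+ k)) (trans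
    (cong (λ r → + r + quotient x * + k) (sym (FinP.toℕ-fromℕ< (n%d<d x (+ k)))))
    (ℤP.+-comm (+ toℕ (remainder x)) (quotient x * + k)))

  quotient-mono : ∀ {q₁ q₂ r₁ r₂} → r₂ < k →
                  q₁ * + k + + r₁ ≡ q₂ * + k + + r₂ → q₁ ℤ.≤ q₂
  quotient-mono {q₁} {q₂} {r₁} {r₂} r₂<k eq = ℤP.≮⇒≥ λ q₂<q₁ →
    ℤP.<⇒≱ upper (subst (ℤ.suc q₂ * + k ℤ.≤_) eq (lower q₂<q₁))
    where
    suc-distrib : ℤ.suc q₂ * + k ≡ q₂ * + k + + k
    suc-distrib = trans (ℤP.*-distribʳ-+ (+ k) 1ℤ q₂)
      (trans (cong (_+ q₂ * + k) (ℤP.*-identityˡ (+ k))) (ℤP.+-comm (+ k) (q₂ * + k)))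
    upper : q₂ * + k + + r₂ ℤ.< ℤ.suc q₂ * + k
    upper = subst (q₂ * + k + + r₂ ℤ.<_) (sym suc-distrib) (ℤP.+-monoʳ-< (q₂ * + k) (ℤ.+<+ r₂<k))
    lower : q₂ ℤ.< q₁ → ℤ.suc q₂ * + k ℤ.≤ q₁ * + k + + r₁
    lower q₂<q₁ = ℤP.≤-trans (ℤP.*-monoʳ-≤-nonNeg (+ k) (ℤP.i<j⇒suc[i]≤j q₂<q₁))
                             (ℤP.i≤i+j (q₁ * + k) (+ r₁))

  divMod-unique : ∀ {x} q (r : Fin k) → x ≡ q * + k + + toℕ r →
                  quotient x ≡ q × remainder x ≡ r
  divMod-unique {x} q r x≡ = q≡ , FinP.toℕ-injective (ℤP.+-injective r≡)
    where
    eq : quotient x * + k + + toℕ (remainder x) ≡ q * + k + + toℕ r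
    eq = trans (sym (euclid x)) x≡
    q≡ : quotient x ≡ q
    q≡ = ℤP.≤-antisym (quotient-mono (FinP.toℕ<n r) eq)
                      (quotient-mono (FinP.toℕ<n (remainder x)) (sym eq))
    r≡ : + toℕ (remainder x) ≡ + toℕ r
    r≡ = ∙-cancelˡ (q * + k) _ _
           (subst (λ y → y * + k + + toℕ (remainder x) ≡ q * + k + + toℕ r) q≡ eq)

  remainder-at : ∀ q r → remainder (q * + k + + toℕ r) ≡ r
  remainder-at q r = proj₂ (divMod-unique q r refl)

  module _ (A D : Fin k → ℤ) where

    IAP-at : ∀ q r → IAP k A D (q * + k + + toℕ r) ≡ A r + q * D r
    IAP-at q r with divMod-unique q r refl
    ... | q≡ , r≡ = cong₂ (λ r′ q′ → A r′ + q′ * D r′) r≡ q≡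

    IAP-shift : ∀ q x → IAP k A D (q * + k + x) ≡ IAP k A D x + q * D (remainder x)
    IAP-shift q x = begin
      IAP k A D (q * + k + x)
        ≡⟨ cong (IAP k A D) (trans (cong (_+_ (q * + k)) (euclid x))
                                   (regroup q (quotient x) (+ k) (+ toℕ r))) ⟩
      IAP k A D ((quotient x + q) * + k + + toℕ r)
        ≡⟨ IAP-at (quotient x + q) r ⟩
      A r + (quotient x + q) * D r
        ≡⟨ distrib (A r) (D r) (quotient x) q ⟩
      A r + quotient x * D r + q * D r ∎
      where
      r = remainder x
      regroup : ∀ q q′ k r → q * k + (q′ * k + r) ≡ (q′ + q) * k + r
      regroup = solve-∀
      distrib : ∀ a d q′ q → a + (q′ + q) * d ≡ a + q′ * d + q * d
      distrib = solve-∀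

  -- Since s < k, the window [-k, (p+1)k) contains the support [s, s + p] of binom p (x - s).
  ∑-binom-window : ∀ p (s : Fin k) (Ψ : ℤ → ℤ) →
    ∑[ n < suc (suc p) ℕ.* k ] (binom p (- + k + + toℕ n - + toℕ s) * Ψ (- + k + + toℕ n))
      ≡ binomialSum Ψ p (+ toℕ s)
  ∑-binom-window p s Ψ = trans (∑ℕ-window (k ℕ.+ toℕ s) (suc p) G bound below above)
                               (sum-cong-≗ {suc p} (inside ∘ toℕ))
    where
    G : ℕ → ℤ
    G n = binom p (- + k + + n - + toℕ s) * Ψ (- + k + + n)
    G≡ : ∀ n → G n ≡ binom p (n ⊖ (k ℕ.+ toℕ s)) * Ψ (- + k + + n)
    G≡ n = cong (λ b → binom p b * Ψ (- + k + + n)) (trans (ring (+ k) (+ n) (+ toℕ s))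
      (trans (cong (λ x → + n - x) (sym (ℤP.pos-+ k (toℕ s)))) (ℤP.m-n≡m⊖n n (k ℕ.+ toℕ s))))
      where
      ring : ∀ k n s → - k + n - s ≡ n - (k + s)
      ring = solve-∀
    inside : ∀ t → G (k ℕ.+ toℕ s ℕ.+ t) ≡ + binomℕ p t * Ψ (+ toℕ s + + t)
    inside t = trans (G≡ (k ℕ.+ toℕ s ℕ.+ t)) (cong₂ _*_ (binom-+⊖ p (k ℕ.+ toℕ s) t) (cong Ψ start))
      where
      ring : ∀ k s t → - k + (k + s + t) ≡ s + t
      ring = solve-∀
      start : - + k + + (k ℕ.+ toℕ s ℕ.+ t) ≡ + toℕ s + + t
      start = trans (cong (λ x → - + k + x)
                          (trans (ℤP.pos-+ (k ℕ.+ toℕ s) t) (cong (_+ + t) (ℤP.pos-+ k (toℕ s)))))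
                    (ring (+ k) (+ toℕ s) (+ t))
    below : ∀ n → n < k ℕ.+ toℕ s → G n ≡ 0ℤ
    below n n<k+s = trans (G≡ n) (cong (_* Ψ (- + k + + n)) (binom-⊖-< p n<k+s))
    above : ∀ e → G (k ℕ.+ toℕ s ℕ.+ (suc p ℕ.+ e)) ≡ 0ℤ
    above e = trans (inside (suc p ℕ.+ e))
      (cong (λ b → + b * Ψ (+ toℕ s + + (suc p ℕ.+ e))) (<⇒binomℕ≡0 (ℕP.m≤m+n (suc p) e)))
    bound : k ℕ.+ toℕ s ℕ.+ suc p ≤ suc (suc p) ℕ.* k
    bound = subst (ℕ._≤ suc (suc p) ℕ.* k)
      (sym (trans (ℕP.+-assoc k (toℕ s) (suc p)) (cong (k ℕ.+_) (ℕP.+-suc (toℕ s) p))))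
      (ℕP.+-monoʳ-≤ k (ℕP.+-mono-≤ (FinP.toℕ<n s) (ℕP.m≤m*n p k)))

  ∑-sumAlpha-binom : ∀ p (s : Fin k) (Ψ : ℤ → ℤ) →
    ∑[ r < k ] sumAlpha p (λ α → binom p (α * + k + + toℕ r - + toℕ s) * Ψ (α * + k + + toℕ r))
      ≡ binomialSum Ψ p (+ toℕ s)
  ∑-sumAlpha-binom p s Ψ =
    trans (∑-sumAlpha-window k p (λ x → binom p (x - + toℕ s) * Ψ x)) (∑-binom-window p s Ψ)

-- The block matrix P

Imat-diag : ∀ k (s : Fin k) → Imat k s s ≡ 1ℤ
Imat-diag k s with toℕ s ℕ.≟ toℕ s
... | yes _   = refl
... | no s≢s = ⊥-elim (s≢s refl)

Imat-off : ∀ k {r s : Fin k} → r ≢ s → Imat k r s ≡ 0ℤ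
Imat-off k {r} {s} r≢s with toℕ r ℕ.≟ toℕ s
... | yes r≡s = ⊥-elim (r≢s (FinP.toℕ-injective r≡s))
... | no _    = refl

∑-Imat : ∀ k (f : Fin k → ℤ) s → ∑[ r < k ] (f r * Imat k r s) ≡ f s
∑-Imat (suc k) f s = begin
  ∑[ r < suc k ] (f r * Imat (suc k) r s)
    ≡⟨ sum-remove {i = s} (λ r → f r * Imat (suc k) r s) ⟩
  f s * Imat (suc k) s s + ∑[ j < k ] (f (punchIn s j) * Imat (suc k) (punchIn s j) s)
    ≡⟨ cong₂ _+_ (cong (_*_ (f s)) (Imat-diag (suc k) s)) (∑-0 k off-diagonal) ⟩
  f s * 1ℤ + 0ℤ
    ≡⟨ trans (ℤP.+-identityʳ _) (ℤP.*-identityʳ (f s)) ⟩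
  f s ∎
  where
  off-diagonal : ∀ j → f (punchIn s j) * Imat (suc k) (punchIn s j) s ≡ 0ℤ
  off-diagonal j = trans (cong (_*_ (f (punchIn s j))) (Imat-off (suc k) (FinP.punchInᵢ≢i s j)))
                         (ℤP.*-zeroʳ (f (punchIn s j)))

∑-Wmat : ∀ k p (f : Fin k → ℤ) s →
         ∑[ r < k ] (f r * Wmat k p r s) ≡ ∑[ r < k ] (f r * Cmat k p r s) + signPow (suc p) * f s
∑-Wmat k p f s = begin
  ∑[ r < k ] (f r * (Cmat k p r s + σ * Imat k r s))
    ≡⟨ sum-cong-≗ {k} (λ r → distrib (f r) (Cmat k p r s) σ (Imat k r s)) ⟩
  ∑[ r < k ] (f r * Cmat k p r s + σ * (f r * Imat k r s))
    ≡⟨ ∑-distrib-+ {k} (λ r → f r * Cmat k p r s) (λ r → σ * (f r * Imat k r s)) ⟩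
  ∑[ r < k ] (f r * Cmat k p r s) + ∑[ r < k ] (σ * (f r * Imat k r s))
    ≡⟨ cong (_+_ (∑[ r < k ] (f r * Cmat k p r s)))
            (trans (sym (*-distribˡ-sum {k} σ (λ r → f r * Imat k r s))) (cong (_*_ σ) (∑-Imat k f s))) ⟩
  ∑[ r < k ] (f r * Cmat k p r s) + σ * f s ∎
  where
  σ = signPow (suc p)
  distrib : ∀ a c σ i → a * (c + σ * i) ≡ a * c + σ * (a * i)
  distrib = solve-∀

module _ (k : ℕ) (A D : Fin k → ℤ) where

  concatRow-↑ˡ : ∀ r → concatRow k A D (r ↑ˡ k) ≡ A r
  concatRow-↑ˡ r rewrite FinP.splitAt-↑ˡ k r k = refl

  concatRow-↑ʳ : ∀ r → concatRow k A D (k ↑ʳ r) ≡ D r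
  concatRow-↑ʳ r rewrite FinP.splitAt-↑ʳ k k r = refl

module _ (k p : ℕ) where

  Pmat-↑ˡ-↑ˡ : ∀ r s → Pmat k p (r ↑ˡ k) (s ↑ˡ k) ≡ Wmat k p r s
  Pmat-↑ˡ-↑ˡ r s rewrite FinP.splitAt-↑ˡ k r k | FinP.splitAt-↑ˡ k s k = refl

  Pmat-↑ˡ-↑ʳ : ∀ r s → Pmat k p (r ↑ˡ k) (k ↑ʳ s) ≡ 0ℤ
  Pmat-↑ˡ-↑ʳ r s rewrite FinP.splitAt-↑ˡ k r k | FinP.splitAt-↑ʳ k k s = refl

  Pmat-↑ʳ-↑ˡ : ∀ r s → Pmat k p (k ↑ʳ r) (s ↑ˡ k) ≡ Tmat k p r s
  Pmat-↑ʳ-↑ˡ r s rewrite FinP.splitAt-↑ʳ k k r | FinP.splitAt-↑ˡ k s k = refl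

  Pmat-↑ʳ-↑ʳ : ∀ r s → Pmat k p (k ↑ʳ r) (k ↑ʳ s) ≡ Wmat k p r s
  Pmat-↑ʳ-↑ʳ r s rewrite FinP.splitAt-↑ʳ k k r | FinP.splitAt-↑ʳ k k s = refl

  module _ (A D : Fin k → ℤ) where

    private
      V : Fin (k ℕ.+ k) → ℤ
      V = vecMat (k ℕ.+ k) (concatRow k A D) (Pmat k p)

    vecMat-Pmat-↑ˡ : ∀ s → V (s ↑ˡ k) ≡ ∑[ r < k ] (A r * Wmat k p r s) + ∑[ r < k ] (D r * Tmat k p r s)
    vecMat-Pmat-↑ˡ s = begin
      sumFin (k ℕ.+ k) (λ r → concatRow k A D r * Pmat k p r (s ↑ˡ k))
        ≡⟨ trans (sumFin≡∑ (k ℕ.+ k) _) (∑-↑ k k (λ r → concatRow k A D r * Pmat k p r (s ↑ˡ k))) ⟩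
      ∑[ r < k ] (concatRow k A D (r ↑ˡ k) * Pmat k p (r ↑ˡ k) (s ↑ˡ k))
        + ∑[ r < k ] (concatRow k A D (k ↑ʳ r) * Pmat k p (k ↑ʳ r) (s ↑ˡ k))
        ≡⟨ cong₂ _+_ (sum-cong-≗ {k} (λ r → cong₂ _*_ (concatRow-↑ˡ k A D r) (Pmat-↑ˡ-↑ˡ r s)))
                     (sum-cong-≗ {k} (λ r → cong₂ _*_ (concatRow-↑ʳ k A D r) (Pmat-↑ʳ-↑ˡ r s))) ⟩
      ∑[ r < k ] (A r * Wmat k p r s) + ∑[ r < k ] (D r * Tmat k p r s) ∎

    vecMat-Pmat-↑ʳ : ∀ s → V (k ↑ʳ s) ≡ ∑[ r < k ] (D r * Wmat k p r s)
    vecMat-Pmat-↑ʳ s = begin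
      sumFin (k ℕ.+ k) (λ r → concatRow k A D r * Pmat k p r (k ↑ʳ s))
        ≡⟨ trans (sumFin≡∑ (k ℕ.+ k) _) (∑-↑ k k (λ r → concatRow k A D r * Pmat k p r (k ↑ʳ s))) ⟩
      ∑[ r < k ] (concatRow k A D (r ↑ˡ k) * Pmat k p (r ↑ˡ k) (k ↑ʳ s))
        + ∑[ r < k ] (concatRow k A D (k ↑ʳ r) * Pmat k p (k ↑ʳ r) (k ↑ʳ s))
        ≡⟨ cong₂ _+_ (∑-0 k upper-right)
                     (sum-cong-≗ {k} (λ r → cong₂ _*_ (concatRow-↑ʳ k A D r) (Pmat-↑ʳ-↑ʳ r s))) ⟩
      0ℤ + ∑[ r < k ] (D r * Wmat k p r s)
        ≡⟨ ℤP.+-identityˡ _ ⟩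
      ∑[ r < k ] (D r * Wmat k p r s) ∎
      where
      upper-right : ∀ r → concatRow k A D (r ↑ˡ k) * Pmat k p (r ↑ˡ k) (k ↑ʳ s) ≡ 0ℤ
      upper-right r = trans (cong (_*_ (concatRow k A D (r ↑ˡ k))) (Pmat-↑ˡ-↑ʳ r s))
                            (ℤP.*-zeroʳ (concatRow k A D (r ↑ˡ k)))

module _ (k : ℕ) .{{_ : NonZero k}} (A D : Fin k → ℤ) (p : ℕ) where

  private
    u : ℤ → ℤ
    u = IAP k A D
    σ : ℤ
    σ = signPow p
    V : Fin (k ℕ.+ k) → ℤ
    V = vecMat (k ℕ.+ k) (concatRow k A D) (Pmat k p)
    b : Fin k → Fin k → ℤ → ℤ
    b s r α = binom p (α * + k + + toℕ r - + toℕ s)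

  ∑[A*C+D*T]≡binomialSum : ∀ s →
    ∑[ r < k ] (A r * Cmat k p r s + D r * Tmat k p r s) ≡ binomialSum u p (+ toℕ s)
  ∑[A*C+D*T]≡binomialSum s =
    trans (sum-cong-≗ {k} (λ r → sumAlpha-linear p (A r) (D r) (entry r))) (∑-sumAlpha-binom k p s u)
    where
    ring : ∀ a d α b → a * b + d * (α * b) ≡ b * (a + α * d)
    ring = solve-∀
    entry : ∀ r α → A r * b s r α + D r * (α * b s r α) ≡ b s r α * u (α * + k + + toℕ r)
    entry r α = trans (ring (A r) (D r) α (b s r α)) (cong (_*_ (b s r α)) (sym (IAP-at k A D α r)))

  ∑[D*C]≡binomialSum : ∀ s → ∑[ r < k ] (D r * Cmat k p r s) ≡ binomialSum (D ∘ remainder k) p (+ toℕ s)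
  ∑[D*C]≡binomialSum s =
    trans (sum-cong-≗ {k} (λ r → sumAlpha-scale p (D r) (entry r))) (∑-sumAlpha-binom k p s (D ∘ remainder k))
    where
    entry : ∀ r α → D r * b s r α ≡ b s r α * D (remainder k (α * + k + + toℕ r))
    entry r α = trans (ℤP.*-comm (D r) (b s r α)) (cong (λ r′ → b s r α * D r′) (sym (remainder-at k α r)))

  vecMat-↑ˡ≡binomialSum : ∀ s → V (s ↑ˡ k) ≡ binomialSum u p (+ toℕ s) + - σ * A s
  vecMat-↑ˡ≡binomialSum s = begin
    V (s ↑ˡ k)
      ≡⟨ vecMat-Pmat-↑ˡ k p A D s ⟩
    ∑[ r < k ] (A r * Wmat k p r s) + ∑DT
      ≡⟨ cong (_+ ∑DT) (∑-Wmat k p A s) ⟩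
    ∑[ r < k ] (A r * Cmat k p r s) + - σ * A s + ∑DT
      ≡⟨ swap (∑[ r < k ] (A r * Cmat k p r s)) (- σ * A s) ∑DT ⟩
    ∑[ r < k ] (A r * Cmat k p r s) + ∑DT + - σ * A s
      ≡⟨ cong (_+ - σ * A s) (∑-distrib-+ {k} (λ r → A r * Cmat k p r s) (λ r → D r * Tmat k p r s)) ⟨
    ∑[ r < k ] (A r * Cmat k p r s + D r * Tmat k p r s) + - σ * A s
      ≡⟨ cong (_+ - σ * A s) (∑[A*C+D*T]≡binomialSum s) ⟩
    binomialSum u p (+ toℕ s) + - σ * A s ∎
    where
    ∑DT = ∑[ r < k ] (D r * Tmat k p r s)
    swap : ∀ a b c → a + b + c ≡ a + c + b
    swap = solve-∀

  vecMat-↑ʳ≡binomialSum : ∀ s → V (k ↑ʳ s) ≡ binomialSum (D ∘ remainder k) p (+ toℕ s) + - σ * D s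
  vecMat-↑ʳ≡binomialSum s = trans (vecMat-Pmat-↑ʳ k p A D s)
    (trans (∑-Wmat k p D s) (cong (_+ - σ * D s) (∑[D*C]≡binomialSum s)))

  orbit-return-gap : ∀ q s → orbit u p (q * + k + + toℕ s) - u (q * + k + + toℕ s)
                             ≡ σ * (V (s ↑ˡ k) + q * V (k ↑ʳ s))
  orbit-return-gap q s = begin
    orbit u p x - u x
      ≡⟨ cong₂ _-_ (orbit≡binomialSum u p x) (IAP-at k A D q s) ⟩
    σ * binomialSum u p x - (A s + q * D s)
      ≡⟨ cong (λ y → σ * y - (A s + q * D s))
              (binomialSum-shift {u} {D ∘ remainder k} (q * + k) q (IAP-shift k A D q) p (+ toℕ s)) ⟩
    σ * (Bu + q * BD) - (A s + q * D s)
      ≡⟨ ring₁ σ Bu BD (A s) (D s) q ⟩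
    σ * (Bu + q * BD) - 1ℤ * (A s + q * D s)
      ≡⟨ cong (λ y → σ * (Bu + q * BD) - y * (A s + q * D s)) (signPow-square p) ⟨
    σ * (Bu + q * BD) - σ * σ * (A s + q * D s)
      ≡⟨ ring₂ σ Bu BD (A s) (D s) q ⟩
    σ * (Bu + - σ * A s + q * (BD + - σ * D s))
      ≡⟨ cong₂ (λ a d → σ * (a + q * d)) (vecMat-↑ˡ≡binomialSum s) (vecMat-↑ʳ≡binomialSum s) ⟨
    σ * (V (s ↑ˡ k) + q * V (k ↑ʳ s)) ∎
    where
    x = q * + k + + toℕ s
    Bu = binomialSum u p (+ toℕ s)
    BD = binomialSum (D ∘ remainder k) p (+ toℕ s)
    ring₁ : ∀ σ a b c d q → σ * (a + q * b) - (c + q * d) ≡ σ * (a + q * b) - 1ℤ * (c + q * d)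
    ring₁ = solve-∀
    ring₂ : ∀ σ a b c d q → σ * (a + q * b) - σ * σ * (c + q * d)
                            ≡ σ * (a + - σ * c + q * (b + - σ * d))
    ring₂ = solve-∀

-- Congruences and periodicity

quot-nonZero : ∀ m g .{{_ : NonZero g}} → quot m g ≡ m / g
quot-nonZero m (suc g) = refl

∣*⇔quot-gcd∣ : ∀ m {c} d → 0 < c → m ∣ c ℕ.* d ⇔ quot m (gcd c m) ∣ d
∣*⇔quot-gcd∣ m {c} d c>0 =
  subst (λ n → m ∣ c ℕ.* d ⇔ n ∣ d) (sym (quot-nonZero m g)) (mk⇔ to from)
  where
  g = gcd c m
  instance
    g≢0 : NonZero g
    g≢0 = ℕ.≢-nonZero (gcd[m,n]≢0 c m (inj₁ (ℕP.>⇒≢ c>0)))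
  m≡ : g ℕ.* (m / g) ≡ m
  m≡ = ℕD.m*[n/m]≡n (gcd[m,n]∣n c m)
  c≡ : g ℕ.* (c / g) ≡ c
  c≡ = ℕD.m*[n/m]≡n (gcd[m,n]∣m c m)
  g*cd : g ℕ.* (c / g ℕ.* d) ≡ c ℕ.* d
  g*cd = trans (sym (ℕP.*-assoc g (c / g) d)) (cong (ℕ._* d) c≡)
  to : m ∣ c ℕ.* d → m / g ∣ d
  to m∣cd = coprime-divisor (Coprime.sym (coprime-/gcd c m))
                            (ℕ∣.*-cancelˡ-∣ g (subst₂ _∣_ (sym m≡) (sym g*cd) m∣cd))
  from : m / g ∣ d → m ∣ c ℕ.* d
  from m/g∣d = subst₂ _∣_ m≡ g*cd (ℕ∣.*-monoʳ-∣ g (ℕ∣.∣n⇒∣m*n (c / g) m/g∣d))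

≡mod⇒∣ : ∀ {m} x y → x ≡ y [mod m ] → + m ℤ∣.∣ x - y
≡mod⇒∣ x y = ℤ∣.∣ᵤ⇒∣

∣⇒≡mod : ∀ {m} x y → + m ℤ∣.∣ x - y → x ≡ y [mod m ]
∣⇒≡mod x y = ℤ∣.∣⇒∣ᵤ

≡0mod⇒∣ : ∀ {m} x → x ≡ 0ℤ [mod m ] → + m ℤ∣.∣ x
≡0mod⇒∣ {m} x x≡0 = subst (+ m ℤ∣.∣_) (ℤP.+-identityʳ x) (≡mod⇒∣ x 0ℤ x≡0)

∣⇒≡0mod : ∀ {m} x → + m ℤ∣.∣ x → x ≡ 0ℤ [mod m ]
∣⇒≡0mod {m} x m∣x = ∣⇒≡mod x 0ℤ (subst (+ m ℤ∣.∣_) (sym (ℤP.+-identityʳ x)) m∣x)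

negate-sum-≡mod : ∀ {m} (a b a′ b′ : ℤ) → a ≡ a′ [mod m ] → b ≡ b′ [mod m ] →
                  (- a - b) ≡ (- a′ - b′) [mod m ]
negate-sum-≡mod {m} a b a′ b′ a≡a′ b≡b′ = ∣⇒≡mod (- a - b) (- a′ - b′)
  (subst (+ m ℤ∣.∣_) (ring a b a′ b′) (ℤ∣.∣m∣n⇒∣m-n (ℤ∣.∣m⇒∣-m (≡mod⇒∣ a a′ a≡a′)) (≡mod⇒∣ b b′ b≡b′)))
  where
  ring : ∀ a b a′ b′ → - (a - a′) - (b - b′) ≡ - a - b - (- a′ - b′)
  ring = solve-∀

∣signPow*⇒∣ : ∀ {n} p x → n ℤ∣.∣ signPow p * x → n ℤ∣.∣ x
∣signPow*⇒∣ {n} p x n∣σx = subst (n ℤ∣.∣_) σσx≡x (ℤ∣.∣n⇒∣m*n (signPow p) n∣σx)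
  where
  σσx≡x : signPow p * (signPow p * x) ≡ x
  σσx≡x = trans (sym (ℤP.*-assoc (signPow p) (signPow p) x))
                (trans (cong (_* x) (signPow-square p)) (ℤP.*-identityˡ x))

∣-affine⇔ : ∀ {n} a d → (∀ q → n ℤ∣.∣ a + q * d) ⇔ (n ℤ∣.∣ a × n ℤ∣.∣ d)
∣-affine⇔ {n} a d = mk⇔ (λ h → at0 h , ℤ∣.∣m+n∣m⇒∣n (at1 h) (at0 h))
                        (λ (n∣a , n∣d) q → ℤ∣.∣m∣n⇒∣m+n n∣a (ℤ∣.∣n⇒∣m*n q n∣d))
  where
  at0 : (∀ q → n ℤ∣.∣ a + q * d) → n ℤ∣.∣ a
  at0 h = subst (n ℤ∣.∣_) (ℤP.+-identityʳ a) (h 0ℤ)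
  at1 : (∀ q → n ℤ∣.∣ a + q * d) → n ℤ∣.∣ a + d
  at1 h = subst (n ℤ∣.∣_) (cong (_+_ a) (ℤP.*-identityˡ d)) (h 1ℤ)

orbit-periodic⇔ : ∀ m (u : ℤ → ℤ) p q →
  Periodic m (orbit u) p q ⇔
    ((∀ j → u (j + + p) ≡ u j [mod m ]) × (∀ j → orbit u q j ≡ u j [mod m ]))
orbit-periodic⇔ m u p q = mk⇔ (λ per → proj₂ ∘ per 0 , proj₁ ∘ per 0)
                              (λ (h , v) i j → vertical v i j , horizontal h i j)
  where
  vertical : (∀ j → orbit u q j ≡ u j [mod m ]) →
             ∀ i j → orbit u (i ℕ.+ q) j ≡ orbit u i j [mod m ]
  vertical v zero    j = v j
  vertical v (suc i) j = negate-sum-≡mod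
    (orbit u (i ℕ.+ q) j) (orbit u (i ℕ.+ q) (j + 1ℤ)) (orbit u i j) (orbit u i (j + 1ℤ))
    (vertical v i j) (vertical v i (j + 1ℤ))
  swap : ∀ j p → j + 1ℤ + p ≡ j + p + 1ℤ
  swap = solve-∀
  horizontal : (∀ j → u (j + + p) ≡ u j [mod m ]) →
               ∀ i j → orbit u i (j + + p) ≡ orbit u i j [mod m ]
  horizontal h zero    j = h j
  horizontal h (suc i) j = negate-sum-≡mod
    (orbit u i (j + + p)) (orbit u i (j + + p + 1ℤ)) (orbit u i j) (orbit u i (j + 1ℤ))
    (horizontal h i j)
    (subst (λ x → orbit u i x ≡ orbit u i (j + 1ℤ) [mod m ]) (swap j (+ p)) (horizontal h i (j + 1ℤ)))

module _ (k : ℕ) .{{_ : NonZero k}} (A D : Fin k → ℤ) where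

  private
    u : ℤ → ℤ
    u = IAP k A D

  IAP-periodic⇔ : ∀ m {p₁} → 0 < p₁ → k ∣ p₁ →
    (∀ j → u (j + + p₁) ≡ u j [mod m ]) ⇔ (∀ r → D r ≡ 0ℤ [mod quot m (gcd (p₁ / k) m) ])
  IAP-periodic⇔ m {p₁} p₁>0 k∣p₁ = mk⇔ to from
    where
    c = p₁ / k
    c>0 : 0 < c
    c>0 = ℕD.m≥n⇒m/n>0 (ℕ∣.∣⇒≤ {{ℕ.>-nonZero p₁>0}} k∣p₁)
    cancel : ∀ a b → a + b - a ≡ b
    cancel = solve-∀
    difference : ∀ j → ℤ.∣ u (j + + p₁) - u j ∣ ≡ c ℕ.* ℤ.∣ D (remainder k j) ∣
    difference j = begin
      ℤ.∣ u (j + + p₁) - u j ∣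
        ≡⟨ cong (λ x → ℤ.∣ u x - u j ∣) j+p₁≡ ⟩
      ℤ.∣ u (+ c * + k + j) - u j ∣
        ≡⟨ cong (λ x → ℤ.∣ x - u j ∣) (IAP-shift k A D (+ c) j) ⟩
      ℤ.∣ u j + + c * D (remainder k j) - u j ∣
        ≡⟨ cong ℤ.∣_∣ (cancel (u j) (+ c * D (remainder k j))) ⟩
      ℤ.∣ + c * D (remainder k j) ∣
        ≡⟨ ℤP.abs-* (+ c) (D (remainder k j)) ⟩
      c ℕ.* ℤ.∣ D (remainder k j) ∣ ∎
      where
      j+p₁≡ : j + + p₁ ≡ + c * + k + j
      j+p₁≡ = trans (ℤP.+-comm j (+ p₁))
        (cong (_+ j) (trans (cong +_ (sym (ℕD.m/n*n≡m k∣p₁))) (ℤP.pos-* c k)))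
    ∣D∣ : ∀ r → ℤ.∣ D r - 0ℤ ∣ ≡ ℤ.∣ D r ∣
    ∣D∣ r = cong ℤ.∣_∣ (ℤP.+-identityʳ (D r))
    to : (∀ j → u (j + + p₁) ≡ u j [mod m ]) → ∀ r → D r ≡ 0ℤ [mod quot m (gcd c m) ]
    to h r = subst (quot m (gcd c m) ∣_)
      (trans (cong (λ r′ → ℤ.∣ D r′ ∣) (remainder-at k 0ℤ r)) (sym (∣D∣ r)))
      (Equivalence.to (∣*⇔quot-gcd∣ m _ c>0) (subst (m ∣_) (difference (+ toℕ r)) (h (+ toℕ r))))
    from : (∀ r → D r ≡ 0ℤ [mod quot m (gcd c m) ]) → ∀ j → u (j + + p₁) ≡ u j [mod m ]
    from h j = subst (m ∣_) (sym (difference j)) (Equivalence.from (∣*⇔quot-gcd∣ m _ c>0)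
      (subst (quot m (gcd c m) ∣_) (∣D∣ (remainder k j)) (h (remainder k j))))

  return⇔ : ∀ m p → (∀ j → orbit u p j ≡ u j [mod m ]) ⇔
                    (∀ s → vecMat (k ℕ.+ k) (concatRow k A D) (Pmat k p) s ≡ 0ℤ [mod m ])
  return⇔ m p = mk⇔ to from
    where
    V : Fin (k ℕ.+ k) → ℤ
    V = vecMat (k ℕ.+ k) (concatRow k A D) (Pmat k p)
    position : ℤ → Fin k → ℤ
    position q s = q * + k + + toℕ s
    V∣⇔ : ∀ q s → orbit u p (position q s) ≡ u (position q s) [mod m ] ⇔
                  + m ℤ∣.∣ V (s ↑ˡ k) + q * V (k ↑ʳ s)
    V∣⇔ q s = mk⇔
      (λ h → ∣signPow*⇒∣ p _ (subst (+ m ℤ∣.∣_) gap (≡mod⇒∣ (orbit u p x) (u x) h)))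
      (λ h → ∣⇒≡mod (orbit u p x) (u x) (subst (+ m ℤ∣.∣_) (sym gap) (ℤ∣.∣n⇒∣m*n (signPow p) h)))
      where
      x = position q s
      gap : orbit u p x - u x ≡ signPow p * (V (s ↑ˡ k) + q * V (k ↑ʳ s))
      gap = orbit-return-gap k A D p q s
    to : (∀ j → orbit u p j ≡ u j [mod m ]) → ∀ s → V s ≡ 0ℤ [mod m ]
    to h = ↑-cases (λ s → ∣⇒≡0mod (V (s ↑ˡ k)) (proj₁ (both s)))
                   (λ s → ∣⇒≡0mod (V (k ↑ʳ s)) (proj₂ (both s)))
      where
      both : ∀ s → + m ℤ∣.∣ V (s ↑ˡ k) × + m ℤ∣.∣ V (k ↑ʳ s)
      both s = Equivalence.to (∣-affine⇔ (V (s ↑ˡ k)) (V (k ↑ʳ s)))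
                              (λ q → Equivalence.to (V∣⇔ q s) (h (position q s)))
    from : (∀ s → V s ≡ 0ℤ [mod m ]) → ∀ j → orbit u p j ≡ u j [mod m ]
    from h j = subst (λ x → orbit u p x ≡ u x [mod m ]) (sym (euclid k j))
      (Equivalence.from (V∣⇔ q s) (Equivalence.from (∣-affine⇔ (V (s ↑ˡ k)) (V (k ↑ʳ s)))
        (≡0mod⇒∣ (V (s ↑ˡ k)) (h (s ↑ˡ k)) , ≡0mod⇒∣ (V (k ↑ʳ s)) (h (k ↑ʳ s))) q))
      where
      q = quotient k j
      s = remainder k j

theorem5 : (m k : ℕ) .{{_ : NonZero k}} (A D : Fin k → ℤ) (p₁ p₂ : ℕ) →
  0 < p₁ → 0 < p₂ → k ∣ p₁ →
  Periodic m (orbit (IAP k A D)) p₁ p₂ ⇔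
    ((∀ (r : Fin k) → D r ≡ 0ℤ [mod quot m (gcd (p₁ / k) m) ])
      × (∀ (s : Fin (k ℕ.+ k)) → vecMat (k ℕ.+ k) (concatRow k A D) (Pmat k p₂) s ≡ 0ℤ [mod m ]))
theorem5 m k A D p₁ p₂ p₁>0 _ k∣p₁ =
  (IAP-periodic⇔ k A D m p₁>0 k∣p₁ ×-⇔ return⇔ k A D m p₂) ⇔-∘ orbit-periodic⇔ m (IAP k A D) p₁ p₂
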